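{- For every integer $n\ge 1$, the polynomial $L_n(q)=\sum_{s=0}^{n} L_{n,s}\,q^s$ is unimodal, i.e. there is an index $m$ with $L_{n,0}\le L_{n,1}\le\cdots\le L_{n,m}\ge L_{n,m+1}\ge\cdots\ge L_{n,n}$.
   Context: A linear chord diagram with $n$ chords is a partition of $[2n]=\{1,2,\dots,2n\}$ into $n$ blocks of size two, called chords. For a chord $\{a,b\}$ with $a<b$, its length is $b-a$. A short chord is a chord of length one, i.e. a block of the form $\{i,i+1\}$. $L_{n,s}$ denotes the number of linear chord diagrams with $n$ chords having exactly $s$ short chords. -}

module Defs where

open import Data.Nat using (ℕ; zero; suc; _+_; _≤_; _<_)
import Data.Nat as ℕ
open import Data.Fin using (Fin; toℕ)
import Data.Fin as Fin
open import Data.Fin.Properties using (all?)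
open import Data.Vec using (Vec; []; _∷_; lookup)
open import Data.List using (List; [_]; concatMap; map; filter; length; allFin)
open import Data.Product using (_×_; ∃; _,_)
open import Relation.Nullary using (¬_; Dec; yes; no)
open import Relation.Nullary.Decidable using (_×-dec_; ¬?)
open import Relation.Binary.PropositionalEquality using (_≡_)

-- A linear chord diagram on [2n] (points encoded as Fin (2n), i.e. 0..2n-1)
-- is represented by its partner map v : i ↦ partner of i, i.e. a
-- fixed-point-free involution (vector encoding, so equality is decidable).
IsChordDiagram : {m : ℕ} → Vec (Fin m) m → Set
IsChordDiagram {m} v = (i : Fin m) → (lookup v (lookup v i) ≡ i) × ¬ (lookup v i ≡ i)

isChordDiagram? : {m : ℕ} → (v : Vec (Fin m) m) → Dec (IsChordDiagram v)
isChordDiagram? v = all? (λ i → (lookup v (lookup v i) Fin.≟ i) ×-dec ¬? (lookup v i Fin.≟ i))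

shortCount : {m : ℕ} → Vec (Fin m) m → ℕ
shortCount {m} v = length (filter (λ i → toℕ (lookup v i) ℕ.≟ suc (toℕ i)) (allFin m))

allVecs : (m k : ℕ) → List (Vec (Fin m) k)
allVecs m zero = [ [] ]
allVecs m (suc k) = concatMap (λ x → map (x ∷_) (allVecs m k)) (allFin m)

L : ℕ → ℕ → ℕ
L n s = length (filter (λ v → isChordDiagram? v ×-dec (shortCount v ℕ.≟ s)) (allVecs (n + n) (n + n)))

Unimodal : (a : ℕ → ℕ) → ℕ → Set
Unimodal a n = ∃ λ m → m ≤ n
  × ((i : ℕ) → i < m → a i ≤ a (suc i))
  × ((i : ℕ) → m ≤ i → i < n → a (suc i) ≤ a i)

-- The
-- sequence is non-increasing from s = 1 on, so it is unimodal with its peak at 0 or 1.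
-- The heart of the proof is an injection from diagrams with s+2 short chords to diagrams
-- with s+1 of them.  Let {i, i+1} and {j, j+1} be the two rightmost short chords.  We relabel
-- the points by a small permutation g (the chord {x, y} becomes {g x, g y}):
--   * j = i+2:                   the 3-cycle i ↦ i+2 ↦ i+3 ↦ i   (AdjacentRule),
--   * j ≥ i+3, i+2 paired with j-1: the 3-cycle i ↦ i+2 ↦ j+1 ↦ i (ApartRule),
--   * otherwise:                 the transposition of i+1 and j-1 (SwapRule).
-- Each rule removes exactly one short chord and leaves a trace from which the rule and its
-- parameters can be read off: the point just before the new last short chord is paired with
-- a point that determines g.  Undoing g is therefore a left inverse of the map, which makes
-- it injective.

module Submission where

open import Data.Bool using (Bool; true; false; if_then_else_; _∧_; not)
open import Data.Empty using (⊥-elim)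
open import Data.Maybe using (Maybe; just; nothing; maybe; _>>=_)
import Data.Maybe as Maybe
open import Data.Fin using (Fin; toℕ; fromℕ<)
open import Data.Fin.Properties using (toℕ-fromℕ<; fromℕ<-toℕ; toℕ-injective; toℕ<n)
open import Data.List using (List; []; _∷_; [_]; _++_; length; map; filter; allFin; applyUpTo; upTo; tabulate)
open import Data.List.Properties using (length-++; map-tabulate; upTo-∷ʳ; filter-++)
open import Data.List.Membership.Propositional using (_∈_; _∉_)
open import Data.List.Membership.Propositional.Properties
  using (∈-∃++; ∈-++⁻; ∈-++⁺ˡ; ∈-++⁺ʳ; ∈-concat⁺′; ∈-map⁺; ∈-map⁻; ∈-allFin; ∈-filter⁺; ∈-filter⁻)
open import Data.List.Relation.Unary.Any using (here; there)
open import Data.List.Relation.Unary.All using (All; []; _∷_)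
import Data.List.Relation.Unary.All as All
import Data.List.Relation.Unary.All.Properties as All
open import Data.List.Relation.Unary.AllPairs using (AllPairs; []; _∷_)
import Data.List.Relation.Unary.AllPairs as AllPairs
import Data.List.Relation.Unary.AllPairs.Properties as AllPairs
open import Data.List.Relation.Unary.Unique.Propositional using (Unique)
open import Data.List.Relation.Binary.Disjoint.Propositional using (Disjoint)
import Data.List.Relation.Unary.Unique.Propositional.Properties as Unique
open import Data.Nat using (ℕ; zero; suc; pred; _+_; _≤_; _<_; z≤n; z<s; s≤s; s≤s⁻¹; _≟_; _<?_; _≤?_)
open import Data.Nat.Properties
open import Data.Nat.ListAction using (sum)
open import Data.Product using (Σ; _×_; _,_; proj₁; proj₂; ∃₂)
open import Data.Sum using (inj₁; inj₂)
open import Data.Vec using (Vec; []; _∷_; lookup)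
import Data.Vec as Vec
import Data.Vec.Properties as Vec
open import Data.Nat.Tactic.RingSolver using (solve-∀)
open import Function using (_∘_)
open import Level using (0ℓ)
open import Relation.Nullary using (¬_; Dec; yes; no; does; contradiction)
open import Relation.Nullary.Decidable using (dec-true; dec-false; _×-dec_)
open import Relation.Unary using (Pred; Decidable)
open import Relation.Binary.Definitions using (tri<; tri≈; tri>)
open import Relation.Binary.PropositionalEquality
  using (_≡_; _≢_; refl; sym; trans; cong; cong₂; subst; module ≡-Reasoning)

open import Defs

∈-remove : ∀ {A : Set} {x y : A} (us ws : List A) → y ∈ us ++ x ∷ ws → y ≢ x → y ∈ us ++ ws
∈-remove us ws y∈ y≢x with ∈-++⁻ us y∈
... | inj₁ y∈us = ∈-++⁺ˡ y∈us
... | inj₂ (here y≡x) = ⊥-elim (y≢x y≡x)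
... | inj₂ (there y∈ws) = ∈-++⁺ʳ us y∈ws

injection-length : ∀ {A B : Set} (f : A → B) {xs : List A} {ys : List B} → Unique xs →
  (∀ {x} → x ∈ xs → f x ∈ ys) →
  (∀ {x y} → x ∈ xs → y ∈ xs → f x ≡ f y → x ≡ y) →
  length xs ≤ length ys
injection-length f {[]} _ _ _ = z≤n
injection-length f {x ∷ xs} (x∉xs ∷ uniq) into inj with ∈-∃++ (into (here refl))
... | us , ws , refl = begin
  suc (length xs)              ≤⟨ s≤s (injection-length f uniq into′ (λ p q → inj (there p) (there q))) ⟩
  suc (length (us ++ ws))      ≡⟨ cong suc (length-++ us) ⟩
  suc (length us + length ws)  ≡⟨ +-suc (length us) (length ws) ⟨
  length us + length (f x ∷ ws) ≡⟨ length-++ us ⟨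
  length (us ++ f x ∷ ws)      ∎
  where
  open ≤-Reasoning
  -- f y for another member y differs from f x, so it survives the removal of f x
  into′ : ∀ {y} → y ∈ xs → f y ∈ us ++ ws
  into′ y∈xs = ∈-remove us ws (into (there y∈xs))
    (λ fy≡fx → All.lookup x∉xs y∈xs (sym (inj (there y∈xs) (here refl) fy≡fx)))

filter-length-≤ : ∀ {A : Set} {P Q : Pred A 0ℓ} (P? : Decidable P) (Q? : Decidable Q)
  {xs : List A} → Unique xs → (∀ x → x ∈ xs) → (f g : A → A) →
  (∀ {x} → P x → Q (f x)) → (∀ {x} → P x → g (f x) ≡ x) →
  length (filter P? xs) ≤ length (filter Q? xs)
filter-length-≤ {P = P} P? Q? {xs} uniq complete f g P⇒Q retract =
  injection-length f (Unique.filter⁺ P? uniq)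
    (λ {x} x∈ → ∈-filter⁺ Q? (complete (f x)) (P⇒Q (holds x∈)))
    (λ {x} {y} x∈ y∈ fx≡fy → begin
      x         ≡⟨ retract (holds x∈) ⟨
      g (f x)   ≡⟨ cong g fx≡fy ⟩
      g (f y)   ≡⟨ retract (holds y∈) ⟩
      y         ∎)
  where
  open ≡-Reasoning
  holds : ∀ {x} → x ∈ filter P? xs → P x
  holds x∈ = proj₂ (∈-filter⁻ P? {xs = xs} x∈)

allVecs-complete : ∀ m k (v : Vec (Fin m) k) → v ∈ allVecs m k
allVecs-complete m zero [] = here refl
allVecs-complete m (suc k) (x ∷ v) =
  ∈-concat⁺′ (∈-map⁺ (x ∷_) (allVecs-complete m k v)) (∈-map⁺ _ (∈-allFin x))

allVecs-unique : ∀ m k → Unique (allVecs m k)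
allVecs-unique m zero = [] ∷ []
allVecs-unique m (suc k) = Unique.concat⁺ blocks-unique blocks-disjoint
  where
  block : Fin m → List (Vec (Fin m) (suc k))
  block x = map (x ∷_) (allVecs m k)
  blocks-unique : All Unique (map block (allFin m))
  blocks-unique = All.map⁺ (All.tabulate⁺ {f = λ x → x}
    λ x → Unique.map⁺ Vec.∷-injectiveʳ (allVecs-unique m k))
  blocks-disjoint : AllPairs Disjoint (map block (allFin m))
  blocks-disjoint = AllPairs.map⁺ (AllPairs.map disjoint (Unique.allFin⁺ m))
    where
    disjoint : ∀ {x y} → x ≢ y → Disjoint (block x) (block y)
    disjoint x≢y (p , q) with ∈-map⁻ _ p | ∈-map⁻ _ q
    ... | _ , _ , refl | _ , _ , e = x≢y (Vec.∷-injectiveˡ e)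

module _ {m : ℕ} where

  -- The partner of the point k in v, read as a natural number (0 outside [0, m)).
  -- Working with ℕ lets neighbouring points k, suc k, … be written directly.
  partner : Vec (Fin m) m → ℕ → ℕ
  partner v k with k <? m
  ... | yes k<m = toℕ (lookup v (fromℕ< k<m))
  ... | no _ = 0

  partner-toℕ : (v : Vec (Fin m) m) (x : Fin m) → partner v (toℕ x) ≡ toℕ (lookup v x)
  partner-toℕ v x with toℕ x <? m
  ... | yes x<m = cong (λ y → toℕ (lookup v y)) (fromℕ<-toℕ x x<m)
  ... | no x≮m = ⊥-elim (x≮m (toℕ<n x))

  partner-fromℕ< : (v : Vec (Fin m) m) {k : ℕ} (k<m : k < m) →
    partner v k ≡ toℕ (lookup v (fromℕ< k<m))
  partner-fromℕ< v k<m = trans (cong (partner v) (sym (toℕ-fromℕ< k<m))) (partner-toℕ v (fromℕ< k<m))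

  partner-< : (v : Vec (Fin m) m) {k : ℕ} → k < m → partner v k < m
  partner-< v k<m = subst (_< m) (sym (partner-fromℕ< v k<m)) (toℕ<n _)

  partner-ext : (v w : Vec (Fin m) m) → (∀ k → k < m → partner v k ≡ partner w k) → v ≡ w
  partner-ext v w same = begin
    v                    ≡⟨ Vec.tabulate∘lookup v ⟨
    Vec.tabulate (lookup v) ≡⟨ Vec.tabulate-cong (λ x → toℕ-injective (begin
      toℕ (lookup v x)   ≡⟨ partner-toℕ v x ⟨
      partner v (toℕ x)  ≡⟨ same (toℕ x) (toℕ<n x) ⟩
      partner w (toℕ x)  ≡⟨ partner-toℕ w x ⟩
      toℕ (lookup w x)   ∎)) ⟩
    Vec.tabulate (lookup w) ≡⟨ Vec.tabulate∘lookup w ⟩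
    w                    ∎
    where open ≡-Reasoning

  fromPartners : (h : ℕ → ℕ) → (∀ k → k < m → h k < m) → Vec (Fin m) m
  fromPartners h h< = Vec.tabulate (λ x → fromℕ< (h< (toℕ x) (toℕ<n x)))

  partner-fromPartners : (h : ℕ → ℕ) (h< : ∀ k → k < m → h k < m) {k : ℕ} → k < m →
    partner (fromPartners h h<) k ≡ h k
  partner-fromPartners h h< {k} k<m = begin
    partner (fromPartners h h<) k                 ≡⟨ partner-fromℕ< (fromPartners h h<) k<m ⟩
    toℕ (lookup (fromPartners h h<) (fromℕ< k<m)) ≡⟨ cong toℕ (Vec.lookup∘tabulate _ (fromℕ< k<m)) ⟩
    toℕ (fromℕ< (h< _ (toℕ<n (fromℕ< k<m))))      ≡⟨ toℕ-fromℕ< _ ⟩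
    h (toℕ (fromℕ< k<m))                          ≡⟨ cong h (toℕ-fromℕ< k<m) ⟩
    h k                                           ∎
    where open ≡-Reasoning

  IsPairing : Vec (Fin m) m → Set
  IsPairing v = ∀ k → k < m → partner v (partner v k) ≡ k × partner v k ≢ k

  chordDiagram⇒pairing : (v : Vec (Fin m) m) → IsChordDiagram v → IsPairing v
  chordDiagram⇒pairing v cd k k<m = involutive , fixed-point-free
    where
    x : Fin m
    x = fromℕ< k<m
    vk≡ : partner v k ≡ toℕ (lookup v x)
    vk≡ = partner-fromℕ< v k<m
    involutive : partner v (partner v k) ≡ k
    involutive = begin
      partner v (partner v k)           ≡⟨ cong (partner v) vk≡ ⟩
      partner v (toℕ (lookup v x))      ≡⟨ partner-toℕ v (lookup v x) ⟩
      toℕ (lookup v (lookup v x))       ≡⟨ cong toℕ (proj₁ (cd x)) ⟩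
      toℕ x                             ≡⟨ toℕ-fromℕ< k<m ⟩
      k                                 ∎
      where open ≡-Reasoning
    fixed-point-free : partner v k ≢ k
    fixed-point-free vk≡k =
      proj₂ (cd x) (toℕ-injective (trans (sym vk≡) (trans vk≡k (sym (toℕ-fromℕ< k<m)))))

  pairing⇒chordDiagram : (v : Vec (Fin m) m) → IsPairing v → IsChordDiagram v
  pairing⇒chordDiagram v pv x = toℕ-injective involutive ,
    λ vx≡x → proj₂ (pv (toℕ x) (toℕ<n x)) (trans (partner-toℕ v x) (cong toℕ vx≡x))
    where
    involutive : toℕ (lookup v (lookup v x)) ≡ toℕ x
    involutive = begin
      toℕ (lookup v (lookup v x))   ≡⟨ partner-toℕ v (lookup v x) ⟨
      partner v (toℕ (lookup v x))  ≡⟨ cong (partner v) (partner-toℕ v x) ⟨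
      partner v (partner v (toℕ x)) ≡⟨ proj₁ (pv (toℕ x) (toℕ<n x)) ⟩
      toℕ x                         ∎
      where open ≡-Reasoning

  partner-back : {v : Vec (Fin m) m} → IsPairing v → ∀ {x y} → x < m → partner v x ≡ y → partner v y ≡ x
  partner-back pv x<m refl = proj₁ (pv _ x<m)

  partner-injective : {v : Vec (Fin m) m} → IsPairing v → ∀ {x y} → x < m → y < m →
    partner v x ≡ partner v y → x ≡ y
  partner-injective {v} pv {x} {y} x<m y<m same =
    trans (sym (proj₁ (pv x x<m))) (trans (cong (partner v) same) (proj₁ (pv y y<m)))

dec-true⁻¹ : ∀ {A : Set} (a? : Dec A) → does a? ≡ true → A
dec-true⁻¹ (yes a) _ = a

dec-false⁻¹ : ∀ {A : Set} (a? : Dec A) → does a? ≡ false → ¬ A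
dec-false⁻¹ (no ¬a) _ = ¬a

bit : Bool → ℕ
bit true = 1
bit false = 0

count : (ℕ → Bool) → ℕ → ℕ
count p zero = 0
count p (suc b) = bit (p b) + count p b

count-ext : ∀ p q b → (∀ k → k < b → p k ≡ q k) → count p b ≡ count q b
count-ext p q zero same = refl
count-ext p q (suc b) same =
  cong₂ _+_ (cong bit (same b ≤-refl)) (count-ext p q b (λ k k<b → same k (m≤n⇒m≤1+n k<b)))

filter-upTo-length : ∀ {Q : Pred ℕ 0ℓ} (Q? : Decidable Q) b →
  length (filter Q? (upTo b)) ≡ count (does ∘ Q?) b
filter-upTo-length Q? zero = refl
filter-upTo-length Q? (suc b) = begin
  length (filter Q? (upTo (suc b)))                  ≡⟨ cong (length ∘ filter Q?) (upTo-∷ʳ b) ⟨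
  length (filter Q? (upTo b ++ [ b ]))               ≡⟨ cong length (filter-++ Q? (upTo b) [ b ]) ⟩
  length (filter Q? (upTo b) ++ filter Q? [ b ])     ≡⟨ length-++ (filter Q? (upTo b)) ⟩
  length (filter Q? (upTo b)) + length (filter Q? [ b ]) ≡⟨ cong₂ _+_ (filter-upTo-length Q? b) singleton ⟩
  count (does ∘ Q?) b + bit (does (Q? b))            ≡⟨ +-comm _ (bit (does (Q? b))) ⟩
  count (does ∘ Q?) (suc b)                          ∎
  where
  open ≡-Reasoning
  singleton : length (filter Q? [ b ]) ≡ bit (does (Q? b))
  singleton with Q? b
  ... | yes _ = refl
  ... | no _ = refl

filter-map-length : ∀ {A : Set} {P : Pred A 0ℓ} {Q : Pred ℕ 0ℓ} (P? : Decidable P) (Q? : Decidable Q)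
  (g : A → ℕ) → (∀ x → does (P? x) ≡ does (Q? (g x))) →
  ∀ xs → length (filter P? xs) ≡ length (filter Q? (map g xs))
filter-map-length P? Q? g corr [] = refl
filter-map-length P? Q? g corr (x ∷ xs) with P? x | Q? (g x) | corr x
... | yes _ | yes _ | _ = cong suc (filter-map-length P? Q? g corr xs)
... | no _ | no _ | _ = filter-map-length P? Q? g corr xs

tabulate-toℕ : ∀ n (f : ℕ → ℕ) → tabulate {n = n} (f ∘ toℕ) ≡ applyUpTo f n
tabulate-toℕ zero f = refl
tabulate-toℕ (suc n) f = cong (f 0 ∷_) (tabulate-toℕ n (f ∘ suc))

map-toℕ-allFin : ∀ n → map toℕ (allFin n) ≡ upTo n
map-toℕ-allFin n = trans (map-tabulate (λ x → x) toℕ) (tabulate-toℕ n (λ k → k))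

module _ {m : ℕ} where

  isShort : Vec (Fin m) m → ℕ → Bool
  isShort v k = does (partner v k ≟ suc k)

  shortCount≡count : (v : Vec (Fin m) m) → shortCount v ≡ count (isShort v) m
  shortCount≡count v = begin
    shortCount v                                            ≡⟨ filter-map-length _ short? toℕ corr (allFin m) ⟩
    length (filter short? (map toℕ (allFin m)))             ≡⟨ cong (length ∘ filter short?) (map-toℕ-allFin m) ⟩
    length (filter short? (upTo m))                         ≡⟨ filter-upTo-length short? m ⟩
    count (isShort v) m                                     ∎
    where
    open ≡-Reasoning
    short? : Decidable (λ k → partner v k ≡ suc k)
    short? k = partner v k ≟ suc k
    corr : ∀ x → does (toℕ (lookup v x) ≟ suc (toℕ x)) ≡ does (short? (toℕ x))
    corr x rewrite partner-toℕ v x = refl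

  isShort-true : (v : Vec (Fin m) m) {k : ℕ} → partner v k ≡ suc k → isShort v k ≡ true
  isShort-true v {k} = dec-true (partner v k ≟ suc k)

  isShort-false : (v : Vec (Fin m) m) {k : ℕ} → partner v k ≢ suc k → isShort v k ≡ false
  isShort-false v {k} = dec-false (partner v k ≟ suc k)

  short-from-isShort : (v : Vec (Fin m) m) {k : ℕ} → isShort v k ≡ true → partner v k ≡ suc k
  short-from-isShort v {k} = dec-true⁻¹ (partner v k ≟ suc k)

  notShort-from-isShort : (v : Vec (Fin m) m) {k : ℕ} → isShort v k ≡ false → partner v k ≢ suc k
  notShort-from-isShort v {k} = dec-false⁻¹ (partner v k ≟ suc k)

  isShort-cong : (v w : Vec (Fin m) m) {k : ℕ} → partner v k ≡ partner w k → isShort v k ≡ isShort w k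
  isShort-cong v w {k} same = cong (λ y → does (y ≟ suc k)) same

  isShort-neither : (v w : Vec (Fin m) m) {k : ℕ} → partner v k ≢ suc k → partner w k ≢ suc k →
    isShort v k ≡ isShort w k
  isShort-neither v w notShort-v notShort-w = trans (isShort-false v notShort-v) (sym (isShort-false w notShort-w))

record IsLast (p : ℕ → Bool) (b j : ℕ) : Set where
  field
    last<b : j < b
    holds : p j ≡ true
    fails-above : ∀ k → j < k → k < b → p k ≡ false

findLast : (ℕ → Bool) → ℕ → Maybe ℕ
findLast p zero = nothing
findLast p (suc b) = if p b then just b else findLast p b

findLast-nothing : ∀ p b → findLast p b ≡ nothing → count p b ≡ 0
findLast-nothing p zero none = refl
findLast-nothing p (suc b) none with p b
... | false = findLast-nothing p b none

findLast-just : ∀ p b {j} → findLast p b ≡ just j → IsLast p b j × count p b ≡ suc (count p j)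
findLast-just p (suc b) found with p b in pb
findLast-just p (suc b) refl | true =
  record { last<b = ≤-refl ; holds = pb ; fails-above = λ k b<k k<1+b → ⊥-elim (<⇒≱ b<k (s≤s⁻¹ k<1+b)) }
  , refl
findLast-just p (suc b) {j} found | false with findLast-just p b found
... | last , counted = record
  { last<b = m≤n⇒m≤1+n (IsLast.last<b last)
  ; holds = IsLast.holds last
  ; fails-above = fails-above } , counted
  where
  fails-above : ∀ k → j < k → k < suc b → p k ≡ false
  fails-above k j<k k<1+b with k ≟ b
  ... | yes refl = pb
  ... | no k≢b = IsLast.fails-above last k j<k (≤∧≢⇒< (≤-pred k<1+b) k≢b)

findLast-complete : ∀ p b {j} → IsLast p b j → findLast p b ≡ just j
findLast-complete p (suc b) {j} last with p b in pb | j ≟ b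
... | true | yes refl = refl
... | true | no j≢b = contradiction (trans (sym pb) (IsLast.fails-above last b j<b ≤-refl)) λ ()
  where j<b = ≤∧≢⇒< (≤-pred (IsLast.last<b last)) j≢b
... | false | yes refl = contradiction (trans (sym pb) (IsLast.holds last)) λ ()
... | false | no j≢b = findLast-complete p b record
  { last<b = ≤∧≢⇒< (≤-pred (IsLast.last<b last)) j≢b
  ; holds = IsLast.holds last
  ; fails-above = λ k j<k k<b → IsLast.fails-above last k j<k (m≤n⇒m≤1+n k<b) }

lastTwo : (ℕ → Bool) → ℕ → Maybe (ℕ × ℕ)
lastTwo p b = findLast p b >>= λ j → Maybe.map (_, j) (findLast p j)

lastTwo-spec : ∀ p b t → count p b ≡ suc (suc t) →
  ∃₂ λ i j → lastTwo p b ≡ just (i , j) × IsLast p b j × IsLast p j i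
lastTwo-spec p b t counted with findLast p b in found-j
... | nothing = ⊥-elim (0≢1+n (trans (sym (findLast-nothing p b found-j)) counted))
... | just j with findLast-just p b found-j
...   | last-j , counted-j with findLast p j in found-i
...     | nothing = ⊥-elim (0≢1+n (suc-injective (begin
          suc 0            ≡⟨ cong suc (findLast-nothing p j found-i) ⟨
          suc (count p j)  ≡⟨ counted-j ⟨
          count p b        ≡⟨ counted ⟩
          suc (suc t)      ∎)))
          where open ≡-Reasoning
...     | just i = i , j , refl , last-j , proj₁ (findLast-just p j found-i)

override : (ℕ → Bool) → ℕ → Bool → ℕ → Bool
override p a x k = if does (k ≟ a) then x else p k

override-at : ∀ p a x → override p a x a ≡ x
override-at p a x rewrite dec-true (a ≟ a) refl = refl

override-off : ∀ p a x {k} → k ≢ a → override p a x k ≡ p k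
override-off p a x {k} k≢a rewrite dec-false (k ≟ a) k≢a = refl

count-override : ∀ p a x b → a < b → count p b + bit x ≡ count (override p a x) b + bit (p a)
count-override p a x (suc b) a<1+b with a ≟ b
... | yes refl = begin
  bit (p a) + count p a + bit x           ≡⟨ shuffle (bit (p a)) (count p a) (bit x) ⟩
  bit x + count p a + bit (p a)           ≡⟨ cong₂ (λ y c → bit y + c + bit (p a)) (sym (override-at p a x)) unchanged ⟩
  bit (p′ a) + count p′ a + bit (p a)     ∎
  where
  open ≡-Reasoning
  p′ : ℕ → Bool
  p′ = override p a x
  shuffle : ∀ y c z → y + c + z ≡ z + c + y
  shuffle = solve-∀
  unchanged : count p a ≡ count p′ a
  unchanged = count-ext p p′ a λ k k<a → sym (override-off p a x (<⇒≢ k<a))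
... | no a≢b = begin
  bit (p b) + count p b + bit x           ≡⟨ +-assoc (bit (p b)) _ _ ⟩
  bit (p b) + (count p b + bit x)         ≡⟨ cong₂ (λ y c → bit y + c) (sym (override-off p a x (a≢b ∘ sym)))
                                                (count-override p a x b (≤∧≢⇒< (≤-pred a<1+b) a≢b)) ⟩
  bit (p′ b) + (count p′ b + bit (p a))   ≡⟨ +-assoc (bit (p′ b)) _ _ ⟨
  bit (p′ b) + count p′ b + bit (p a)     ∎
  where
  open ≡-Reasoning
  p′ : ℕ → Bool
  p′ = override p a x

hits : (ℕ → Bool) → List ℕ → ℕ
hits p ds = sum (map bit (map p ds))

hits-ext : ∀ p q ds → All (λ d → p d ≡ q d) ds → hits p ds ≡ hits q ds
hits-ext p q [] [] = refl
hits-ext p q (d ∷ ds) (same ∷ sames) = cong₂ _+_ (cong bit same) (hits-ext p q ds sames)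

count-transfer : ∀ p q b ds → Unique ds → All (_< b) ds →
  (∀ k → k < b → k ∉ ds → p k ≡ q k) → count p b + hits q ds ≡ count q b + hits p ds
count-transfer p q b [] [] [] agree =
  cong (_+ 0) (count-ext p q b λ k k<b → agree k k<b λ ())
count-transfer p q b (d ∷ ds) (d∉ds ∷ distinct) (d<b ∷ ds<b) agree = begin
  count p b + (bit (q d) + hits q ds)      ≡⟨ +-assoc (count p b) _ _ ⟨
  count p b + bit (q d) + hits q ds        ≡⟨ cong (_+ hits q ds) (count-override p d (q d) b d<b) ⟩
  count p′ b + bit (p d) + hits q ds       ≡⟨ shuffle (count p′ b) (bit (p d)) (hits q ds) ⟩
  bit (p d) + (count p′ b + hits q ds)     ≡⟨ cong (bit (p d) +_) (count-transfer p′ q b ds distinct ds<b agree′) ⟩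
  bit (p d) + (count q b + hits p′ ds)     ≡⟨ cong (λ h → bit (p d) + (count q b + h)) p′≡p-on-ds ⟩
  bit (p d) + (count q b + hits p ds)      ≡⟨ shuffle′ (bit (p d)) (count q b) (hits p ds) ⟩
  count q b + (bit (p d) + hits p ds)      ∎
  where
  open ≡-Reasoning
  p′ : ℕ → Bool
  p′ = override p d (q d)
  shuffle : ∀ x y z → x + y + z ≡ y + (x + z)
  shuffle = solve-∀
  shuffle′ : ∀ x y z → x + (y + z) ≡ y + (x + z)
  shuffle′ = solve-∀
  agree′ : ∀ k → k < b → k ∉ ds → p′ k ≡ q k
  agree′ k k<b k∉ds with k ≟ d
  ... | yes refl = override-at p d (q d)
  ... | no k≢d = trans (override-off p d (q d) k≢d)
    (agree k k<b λ { (here k≡d) → k≢d k≡d ; (there k∈ds) → k∉ds k∈ds })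
  p′≡p-on-ds : hits p′ ds ≡ hits p ds
  p′≡p-on-ds = hits-ext p′ p ds (All.map (λ d′≢d → override-off p d (q d) (d′≢d ∘ sym)) d∉ds)

values-hits : ∀ p ds {bs} → map p ds ≡ bs → hits p ds ≡ sum (map bit bs)
values-hits p ds = cong (sum ∘ map bit)

values₃ : ∀ (p : ℕ → Bool) {a b c : ℕ} {x y z : Bool} → p a ≡ x → p b ≡ y → p c ≡ z →
  map p (a ∷ b ∷ c ∷ []) ≡ x ∷ y ∷ z ∷ []
values₃ p pa pb pc = cong₂ _∷_ pa (cong₂ _∷_ pb (cong (_∷ []) pc))

count-drop : ∀ p q b ds → Unique ds → All (_< b) ds → (∀ k → k < b → k ∉ ds → p k ≡ q k) →
  hits p ds ≡ suc (hits q ds) → count p b ≡ suc (count q b)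
count-drop p q b ds distinct ds<b agree more = +-cancelʳ-≡ (hits q ds) _ _ (begin
  count p b + hits q ds            ≡⟨ count-transfer p q b ds distinct ds<b agree ⟩
  count q b + hits p ds            ≡⟨ cong (count q b +_) more ⟩
  count q b + suc (hits q ds)      ≡⟨ +-suc (count q b) (hits q ds) ⟩
  suc (count q b) + hits q ds      ∎)
  where open ≡-Reasoning

swap : ℕ → ℕ → ℕ → ℕ
swap a b k = if does (k ≟ a) then b else if does (k ≟ b) then a else k

swap-first : ∀ a b → swap a b a ≡ b
swap-first a b rewrite dec-true (a ≟ a) refl = refl

swap-second : ∀ a b → swap a b b ≡ a
swap-second a b with b ≟ a
... | yes refl rewrite dec-true (a ≟ a) refl = refl
... | no b≢a rewrite dec-false (b ≟ a) b≢a | dec-true (b ≟ b) refl = refl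

swap-other : ∀ a b {k} → k ≢ a → k ≢ b → swap a b k ≡ k
swap-other a b {k} k≢a k≢b rewrite dec-false (k ≟ a) k≢a | dec-false (k ≟ b) k≢b = refl

swap-involutive : ∀ a b k → swap a b (swap a b k) ≡ k
swap-involutive a b k with k ≟ a | k ≟ b
... | yes refl | _ = trans (cong (swap k b) (swap-first k b)) (swap-second k b)
... | no _ | yes refl = trans (cong (swap a k) (swap-second a k)) (swap-first a k)
... | no k≢a | no k≢b = trans (cong (swap a b) (swap-other a b k≢a k≢b)) (swap-other a b k≢a k≢b)

swap-< : ∀ {m} a b {k} → a < m → b < m → k < m → swap a b k < m
swap-< a b {k} a<m b<m k<m with k ≟ a | k ≟ b
... | yes refl | _ = subst (_< _) (sym (swap-first k b)) b<m
... | no _ | yes refl = subst (_< _) (sym (swap-second a k)) a<m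
... | no k≢a | no k≢b = subst (_< _) (sym (swap-other a b k≢a k≢b)) k<m

cycle-first : ∀ {x y z} → x ≢ y → x ≢ z → swap x y (swap y z x) ≡ y
cycle-first {x} {y} {z} x≢y x≢z = trans (cong (swap x y) (swap-other y z x≢y x≢z)) (swap-first x y)

cycle-second : ∀ {x y z} → z ≢ x → z ≢ y → swap x y (swap y z y) ≡ z
cycle-second {x} {y} {z} z≢x z≢y = trans (cong (swap x y) (swap-first y z)) (swap-other x y z≢x z≢y)

cycle-third : ∀ x y z → swap x y (swap y z z) ≡ x
cycle-third x y z = trans (cong (swap x y) (swap-second y z)) (swap-second x y)

cycle-other : ∀ x y z {k} → k ≢ x → k ≢ y → k ≢ z → swap x y (swap y z k) ≡ k
cycle-other x y z k≢x k≢y k≢z = trans (cong (swap x y) (swap-other y z k≢y k≢z)) (swap-other x y k≢x k≢y)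

-- A move is a product of transpositions, applied from the right.
Move : Set
Move = List (ℕ × ℕ)

permute : Move → ℕ → ℕ
permute [] k = k
permute ((a , b) ∷ τs) k = swap a b (permute τs k)

permute⁻¹ : Move → ℕ → ℕ
permute⁻¹ [] k = k
permute⁻¹ ((a , b) ∷ τs) k = permute⁻¹ τs (swap a b k)

Bounded : ℕ → Move → Set
Bounded m τs = All (λ τ → proj₁ τ < m × proj₂ τ < m) τs

record IsPermutation (m : ℕ) (g g⁻¹ : ℕ → ℕ) : Set where
  field
    g-< : ∀ {k} → k < m → g k < m
    g⁻¹-< : ∀ {k} → k < m → g⁻¹ k < m
    inverseˡ : ∀ k → g⁻¹ (g k) ≡ k
    inverseʳ : ∀ k → g (g⁻¹ k) ≡ k

permutation-sym : ∀ {m g g⁻¹} → IsPermutation m g g⁻¹ → IsPermutation m g⁻¹ g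
permutation-sym perm = record
  { g-< = g⁻¹-< ; g⁻¹-< = g-< ; inverseˡ = inverseʳ ; inverseʳ = inverseˡ }
  where open IsPermutation perm

move-permutation : ∀ {m} τs → Bounded m τs → IsPermutation m (permute τs) (permute⁻¹ τs)
move-permutation [] [] = record
  { g-< = λ k<m → k<m ; g⁻¹-< = λ k<m → k<m ; inverseˡ = λ _ → refl ; inverseʳ = λ _ → refl }
move-permutation ((a , b) ∷ τs) ((a<m , b<m) ∷ bounded) = record
  { g-< = λ k<m → swap-< a b a<m b<m (g-< k<m)
  ; g⁻¹-< = λ k<m → g⁻¹-< (swap-< a b a<m b<m k<m)
  ; inverseˡ = λ k → trans (cong (permute⁻¹ τs) (swap-involutive a b (permute τs k))) (inverseˡ k)
  ; inverseʳ = λ k → trans (cong (swap a b) (inverseʳ (swap a b k))) (swap-involutive a b k) }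
  where open IsPermutation (move-permutation τs bounded)

module _ {m : ℕ} where

  clamp : ℕ → ℕ → ℕ
  clamp k y with y <? m
  ... | yes _ = y
  ... | no _ = k

  clamp-< : ∀ {k} y → k < m → clamp k y < m
  clamp-< y k<m with y <? m
  ... | yes y<m = y<m
  ... | no _ = k<m

  clamp-id : ∀ k {y} → y < m → clamp k y ≡ y
  clamp-id k {y} y<m with y <? m
  ... | yes _ = refl
  ... | no y≮m = ⊥-elim (y≮m y<m)

  -- The image of v under relabelling the points by g: the chord {x, y} becomes {g x, g y}.
  -- (Clamping only makes this total; for a permutation of [0, m) it never acts.)
  relabelled : (g g⁻¹ : ℕ → ℕ) → Vec (Fin m) m → ℕ → ℕ
  relabelled g g⁻¹ v k = clamp k (g (partner v (g⁻¹ k)))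

  relabelled-< : ∀ g g⁻¹ v k → k < m → relabelled g g⁻¹ v k < m
  relabelled-< g g⁻¹ v k = clamp-< (g (partner v (g⁻¹ k)))

  opaque
    conjugate : (g g⁻¹ : ℕ → ℕ) → Vec (Fin m) m → Vec (Fin m) m
    conjugate g g⁻¹ v = fromPartners (relabelled g g⁻¹ v) (relabelled-< g g⁻¹ v)

    partner-conjugate : ∀ {g g⁻¹} → IsPermutation m g g⁻¹ → (v : Vec (Fin m) m) → ∀ {k} → k < m →
      partner (conjugate g g⁻¹ v) k ≡ g (partner v (g⁻¹ k))
    partner-conjugate {g} {g⁻¹} perm v {k} k<m = trans
      (partner-fromPartners (relabelled g g⁻¹ v) (relabelled-< g g⁻¹ v) k<m)
      (clamp-id k (g-< (partner-< v (g⁻¹-< k<m))))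
      where open IsPermutation perm

  module _ {g g⁻¹ : ℕ → ℕ} (perm : IsPermutation m g g⁻¹) (v : Vec (Fin m) m) where
    open IsPermutation perm

    conjugate-image : ∀ {x} → x < m → partner (conjugate g g⁻¹ v) (g x) ≡ g (partner v x)
    conjugate-image {x} x<m = trans (partner-conjugate perm v (g-< x<m)) (cong (g ∘ partner v) (inverseˡ x))

    conjugate-pairing : IsPairing v → IsPairing (conjugate g g⁻¹ v)
    conjugate-pairing pv k k<m = involutive , fixed-point-free
      where
      w : Vec (Fin m) m
      w = conjugate g g⁻¹ v
      x : ℕ
      x = g⁻¹ k
      x<m : x < m
      x<m = g⁻¹-< k<m
      wk≡ : partner w k ≡ g (partner v x)
      wk≡ = partner-conjugate perm v k<m
      involutive : partner w (partner w k) ≡ k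
      involutive = begin
        partner w (partner w k)          ≡⟨ cong (partner w) wk≡ ⟩
        partner w (g (partner v x))      ≡⟨ conjugate-image (partner-< v x<m) ⟩
        g (partner v (partner v x))      ≡⟨ cong g (proj₁ (pv x x<m)) ⟩
        g x                              ≡⟨ inverseʳ k ⟩
        k                                ∎
        where open ≡-Reasoning
      fixed-point-free : partner w k ≢ k
      fixed-point-free wk≡k = proj₂ (pv x x<m) (begin
        partner v x                      ≡⟨ inverseˡ (partner v x) ⟨
        g⁻¹ (g (partner v x))            ≡⟨ cong g⁻¹ (trans (sym wk≡) wk≡k) ⟩
        g⁻¹ k                            ∎)
        where open ≡-Reasoning

  conjugate-cancel : ∀ {g g⁻¹} → IsPermutation m g g⁻¹ → (v : Vec (Fin m) m) →
    conjugate g⁻¹ g (conjugate g g⁻¹ v) ≡ v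
  conjugate-cancel {g} {g⁻¹} perm v = partner-ext _ v λ k k<m → begin
    partner (conjugate g⁻¹ g w) k    ≡⟨ partner-conjugate (permutation-sym perm) w k<m ⟩
    g⁻¹ (partner w (g k))            ≡⟨ cong g⁻¹ (conjugate-image perm v k<m) ⟩
    g⁻¹ (g (partner v k))            ≡⟨ IsPermutation.inverseˡ perm (partner v k) ⟩
    partner v k                      ∎
    where
    open ≡-Reasoning
    w : Vec (Fin m) m
    w = conjugate g g⁻¹ v

applyMove : ∀ {m} → Move → Vec (Fin m) m → Vec (Fin m) m
applyMove τs = conjugate (permute τs) (permute⁻¹ τs)

undoMove : ∀ {m} → Move → Vec (Fin m) m → Vec (Fin m) m
undoMove τs = conjugate (permute⁻¹ τs) (permute τs)

swapMove : ℕ → ℕ → Move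
swapMove i jm = (suc i , jm) ∷ []

cycleMove : ℕ → ℕ → Move
cycleMove i j = (i , 2 + i) ∷ (2 + i , suc j) ∷ []

chooseMove : ∀ {m} → Vec (Fin m) m → ℕ → ℕ → Move
chooseMove v i j = if does (3 + i ≤? j) ∧ not (does (partner v (2 + i) ≟ pred j))
  then swapMove i (pred j) else cycleMove i j

-- The move read off from the reduced diagram: p is the point before its last short chord
-- and x the partner of p.
decodeMove : ℕ → ℕ → Move
decodeMove p x = if does (suc x ≤? p) then swapMove x p
  else if does (x ≟ 3 + p) then cycleMove p (2 + p) else cycleMove p x

module _ {m : ℕ} (v : Vec (Fin m) m) {i j : ℕ} where

  chooseMove-adjacent : ¬ 3 + i ≤ j → chooseMove v i j ≡ cycleMove i j
  chooseMove-adjacent 3+i≰j rewrite dec-false (3 + i ≤? j) 3+i≰j = refl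

  chooseMove-apart : 3 + i ≤ j → partner v (2 + i) ≡ pred j → chooseMove v i j ≡ cycleMove i j
  chooseMove-apart 3+i≤j paired
    rewrite dec-true (3 + i ≤? j) 3+i≤j | dec-true (partner v (2 + i) ≟ pred j) paired = refl

  chooseMove-swap : 3 + i ≤ j → partner v (2 + i) ≢ pred j → chooseMove v i j ≡ swapMove i (pred j)
  chooseMove-swap 3+i≤j unpaired
    rewrite dec-true (3 + i ≤? j) 3+i≤j | dec-false (partner v (2 + i) ≟ pred j) unpaired = refl

decodeMove-swap : ∀ {p x} → suc x ≤ p → decodeMove p x ≡ swapMove x p
decodeMove-swap {p} {x} x<p rewrite dec-true (suc x ≤? p) x<p = refl

decodeMove-cycle : ∀ {p x} → ¬ suc x ≤ p → x ≢ 3 + p → decodeMove p x ≡ cycleMove p x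
decodeMove-cycle {p} {x} x≮p x≢3+p
  rewrite dec-false (suc x ≤? p) x≮p | dec-false (x ≟ 3 + p) x≢3+p = refl

decodeMove-adjacent : ∀ p → decodeMove p (3 + p) ≡ cycleMove p (2 + p)
decodeMove-adjacent p
  rewrite dec-false (4 + p ≤? p) (<⇒≱ (m<n+m p z<s)) | dec-true (3 + p ≟ 3 + p) refl = refl

module _ {m : ℕ} where

  record TwoLast (v : Vec (Fin m) m) (i j : ℕ) : Set where
    field
      i<j : i < j
      1+j<m : suc j < m
      short-i : partner v i ≡ suc i
      short-j : partner v j ≡ suc j
      none-between : ∀ k → i < k → k < j → partner v k ≢ suc k
      none-above : ∀ k → j < k → k < m → partner v k ≢ suc k

  twoLast : {v : Vec (Fin m) m} → IsPairing v → ∀ {i j} →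
    IsLast (isShort v) m j → IsLast (isShort v) j i → TwoLast v i j
  twoLast {v} pv {i} {j} last-j last-i = record
    { i<j = IsLast.last<b last-i
    ; 1+j<m = subst (_< m) short-j (partner-< v (IsLast.last<b last-j))
    ; short-i = short-from-isShort v (IsLast.holds last-i)
    ; short-j = short-j
    ; none-between = λ k i<k k<j → notShort-from-isShort v (IsLast.fails-above last-i k i<k k<j)
    ; none-above = λ k j<k k<m → notShort-from-isShort v (IsLast.fails-above last-j k j<k k<m) }
    where
    short-j : partner v j ≡ suc j
    short-j = short-from-isShort v (IsLast.holds last-j)

  record Reduction (v : Vec (Fin m) m) (τs : Move) : Set where
    field
      bounded : Bounded m τs
      fewer : count (isShort v) m ≡ suc (count (isShort (applyMove τs v)) m)
      marker : ℕ
      marker-last : IsLast (isShort (applyMove τs v)) m marker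
      decodes : decodeMove (pred marker) (partner (applyMove τs v) (pred marker)) ≡ τs

  module TwoLastFacts {v : Vec (Fin m) m} (pv : IsPairing v) {i j : ℕ} (two : TwoLast v i j) where
    open TwoLast two public

    j<m : j < m
    j<m = <-trans (n<1+n j) 1+j<m

    i<m : i < m
    i<m = <-trans i<j j<m

    back-i : partner v (suc i) ≡ i
    back-i = partner-back pv i<m short-i

    back-j : partner v (suc j) ≡ j
    back-j = partner-back pv j<m short-j

    none-after-i : ∀ {k} → i < k → k ≢ j → k < m → partner v k ≢ suc k
    none-after-i {k} i<k k≢j k<m with <-cmp k j
    ... | tri< k<j _ _ = none-between k i<k k<j
    ... | tri≈ _ k≡j _ = ⊥-elim (k≢j k≡j)
    ... | tri> _ _ j<k = none-above k j<k k<m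

    -- i+1 is paired with i, so it cannot start the short chord at j.
    2+i≤j : 2 + i ≤ j
    2+i≤j = ≤∧≢⇒< i<j λ 1+i≡j → <⇒≢ (<-trans i<j (n<1+n j))
      (trans (sym back-i) (trans (cong (partner v) 1+i≡j) short-j))


  -- Rule for j ≥ i+3 when i+2 is not paired with j-1 = jm: transposing i+1 and jm turns the
  -- chords {i, i+1} and {jm, B} into {i, jm} and {i+1, B}.  Only the short chord at i
  -- disappears, {j, j+1} stays the last one, and jm is now paired with i < jm.
  module SwapRule {v : Vec (Fin m) m} (pv : IsPairing v) {i jm : ℕ} (two : TwoLast v i (suc jm))
    (2+i≤jm : 2 + i ≤ jm) (unpaired : partner v (2 + i) ≢ jm) where
    open TwoLastFacts pv two

    a : ℕ
    a = suc i
    j : ℕ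
    j = suc jm
    τs : Move
    τs = swapMove i jm
    w : Vec (Fin m) m
    w = applyMove τs v
    B : ℕ
    B = partner v jm

    a<jm : a < jm
    a<jm = 2+i≤jm
    i<jm : i < jm
    i<jm = <-trans (n<1+n i) a<jm
    jm<m : jm < m
    jm<m = <-trans (n<1+n jm) j<m
    a<m : a < m
    a<m = <-trans a<jm jm<m
    B<m : B < m
    B<m = partner-< v jm<m

    bounded : Bounded m τs
    bounded = (a<m , jm<m) ∷ []

    image : ∀ {x y} → x < m → swap a jm x ≡ y → partner w y ≡ swap a jm (partner v x)
    image x<m refl = conjugate-image (move-permutation τs bounded) v x<m

    v-B : partner v B ≡ jm
    v-B = proj₁ (pv jm jm<m)

    B≢jm : B ≢ jm
    B≢jm = proj₂ (pv jm jm<m)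

    B≢a : B ≢ a
    B≢a B≡a = <⇒≢ i<jm (trans (sym back-i) (trans (cong (partner v) (sym B≡a)) v-B))

    B≢i : B ≢ i
    B≢i B≡i = <⇒≢ a<jm (trans (sym short-i) (trans (cong (partner v) (sym B≡i)) v-B))

    i≢a : i ≢ a
    i≢a = <⇒≢ (n<1+n i)

    i≢jm : i ≢ jm
    i≢jm = <⇒≢ i<jm

    w-i : partner w i ≡ jm
    w-i = trans (image i<m (swap-other a jm i≢a i≢jm)) (trans (cong (swap a jm) short-i) (swap-first a jm))

    w-jm : partner w jm ≡ i
    w-jm = trans (image a<m (swap-first a jm)) (trans (cong (swap a jm) back-i) (swap-other a jm i≢a i≢jm))

    w-a : partner w a ≡ B
    w-a = trans (image jm<m (swap-second a jm)) (swap-other a jm B≢a B≢jm)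

    w-B : partner w B ≡ a
    w-B = trans (image B<m (swap-other a jm B≢a B≢jm)) (trans (cong (swap a jm) v-B) (swap-second a jm))

    w-other : ∀ {k} → k < m → k ≢ i → k ≢ a → k ≢ jm → k ≢ B → partner w k ≡ partner v k
    w-other {k} k<m k≢i k≢a k≢jm k≢B =
      trans (image k<m (swap-other a jm k≢a k≢jm)) (swap-other a jm vk≢a vk≢jm)
      where
      vk≢a : partner v k ≢ a
      vk≢a vk≡a = k≢i (partner-injective pv k<m i<m (trans vk≡a (sym short-i)))
      vk≢jm : partner v k ≢ jm
      vk≢jm vk≡jm = k≢B (sym (partner-back pv k<m vk≡jm))

    agree : ∀ k → k < m → k ≢ i → isShort v k ≡ isShort w k
    agree k k<m k≢i with k ≟ a | k ≟ jm | k ≟ B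
    ... | yes refl | _ | _ = isShort-neither v w
      (λ short → <⇒≢ (<-trans (n<1+n i) (n<1+n a)) (trans (sym back-i) short))
      (λ short → unpaired (trans (cong (partner v) (trans (sym short) w-a)) v-B))
    ... | no _ | yes refl | _ = isShort-neither v w
      (λ short → <⇒≢ (<-trans (n<1+n jm) (n<1+n j)) (trans (sym (partner-back pv jm<m short)) short-j))
      (λ short → <⇒≢ (<-trans i<jm (n<1+n jm)) (trans (sym w-jm) short))
    ... | no _ | no _ | yes refl = isShort-neither v w
      (λ short → let jm≡1+B = trans (sym v-B) short in
        none-between B (s≤s⁻¹ (subst (2 + i ≤_) jm≡1+B 2+i≤jm))
          (<-trans (subst (B <_) (sym jm≡1+B) (n<1+n B)) (n<1+n jm)) short)
      (λ short → B≢i (suc-injective (sym (trans (sym w-B) short))))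
    ... | no k≢a | no k≢jm | no k≢B = isShort-cong v w (sym (w-other k<m k≢i k≢a k≢jm k≢B))

    reduction : Reduction v τs
    reduction = record
      { bounded = bounded
      ; fewer = count-drop (isShort v) (isShort w) m (i ∷ []) ([] ∷ []) (i<m ∷ [])
          (λ k k<m k∉ → agree k k<m (k∉ ∘ here))
          (trans (values-hits (isShort v) (i ∷ []) (cong (_∷ []) (isShort-true v short-i)))
                 (cong suc (sym (values-hits (isShort w) (i ∷ []) (cong (_∷ []) (isShort-false w
                   λ short → <⇒≢ a<jm (sym (trans (sym w-i) short))))))))
      ; marker = j
      ; marker-last = record
        { last<b = j<m
        ; holds = trans (sym (agree j j<m (>⇒≢ i<j))) (isShort-true v short-j)
        ; fails-above = λ k j<k k<m → trans (sym (agree k k<m (>⇒≢ (<-trans i<j j<k))))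
            (isShort-false v (none-above k j<k k<m)) }
      ; decodes = trans (cong (decodeMove jm) w-jm) (decodeMove-swap (<⇒≤ a<jm)) }

  -- The 3-cycle g : i ↦ i+2 ↦ j+1 ↦ i used by both remaining rules.  It turns the short chord
  -- {i, i+1} into the short chord {i+2, i+1} and sends j+1 to i.
  module Cycle {v : Vec (Fin m) m} (pv : IsPairing v) {i j : ℕ} (two : TwoLast v i j) where
    open TwoLastFacts pv two public

    i1 : ℕ
    i1 = suc i
    i2 : ℕ
    i2 = 2 + i
    j1 : ℕ
    j1 = suc j
    τs : Move
    τs = cycleMove i j
    w : Vec (Fin m) m
    w = applyMove τs v
    g : ℕ → ℕ
    g = permute τs

    i<i1 : i < i1
    i<i1 = n<1+n i
    i1<i2 : i1 < i2
    i1<i2 = n<1+n i1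
    i2<j1 : i2 < j1
    i2<j1 = s≤s 2+i≤j
    i1<j1 : i1 < j1
    i1<j1 = <-trans i1<i2 i2<j1
    i<i2 : i < i2
    i<i2 = <-trans i<i1 i1<i2
    i<j1 : i < j1
    i<j1 = <-trans i<i2 i2<j1
    i1<m : i1 < m
    i1<m = <-trans i1<j1 1+j<m
    i2<m : i2 < m
    i2<m = <-trans i2<j1 1+j<m

    bounded : Bounded m τs
    bounded = (i<m , i2<m) ∷ (i2<m , 1+j<m) ∷ []

    image : ∀ {x y} → x < m → g x ≡ y → partner w y ≡ g (partner v x)
    image x<m refl = conjugate-image (move-permutation τs bounded) v x<m

    g-i : g i ≡ i2
    g-i = cycle-first (<⇒≢ i<i2) (<⇒≢ i<j1)

    g-i2 : g i2 ≡ j1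
    g-i2 = cycle-second (>⇒≢ i<j1) (>⇒≢ i2<j1)

    g-j1 : g j1 ≡ i
    g-j1 = cycle-third i i2 j1

    g-other : ∀ {k} → k ≢ i → k ≢ i2 → k ≢ j1 → g k ≡ k
    g-other = cycle-other i i2 j1

    w-i1 : partner w i1 ≡ i2
    w-i1 = trans (image i1<m (g-other (>⇒≢ i<i1) (<⇒≢ i1<i2) (<⇒≢ i1<j1))) (trans (cong g back-i) g-i)

    w-i2 : partner w i2 ≡ i1
    w-i2 = trans (image i<m g-i) (trans (cong g short-i) (g-other (>⇒≢ i<i1) (<⇒≢ i1<i2) (<⇒≢ i1<j1)))

    w-i : partner w i ≡ g j
    w-i = trans (image 1+j<m g-j1) (cong g back-j)

    w-j1 : partner w j1 ≡ g (partner v i2)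
    w-j1 = image i2<m g-i2

    w-other : ∀ {k} → k < m → k ≢ i → k ≢ i1 → k ≢ i2 → k ≢ partner v i2 → k ≢ j → k ≢ j1 →
      partner w k ≡ partner v k
    w-other {k} k<m k≢i k≢i1 k≢i2 k≢vi2 k≢j k≢j1 =
      trans (image k<m (g-other k≢i k≢i2 k≢j1)) (g-other vk≢i vk≢i2 vk≢j1)
      where
      vk≢i : partner v k ≢ i
      vk≢i vk≡i = k≢i1 (trans (sym (partner-back pv k<m vk≡i)) short-i)
      vk≢i2 : partner v k ≢ i2
      vk≢i2 vk≡i2 = k≢vi2 (sym (partner-back pv k<m vk≡i2))
      vk≢j1 : partner v k ≢ j1
      vk≢j1 vk≡j1 = k≢j (trans (sym (partner-back pv k<m vk≡j1)) back-j)

    i1-short : isShort w i1 ≡ true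
    i1-short = isShort-true w w-i1

    i2-notShort : partner w i2 ≢ suc i2
    i2-notShort short = <⇒≢ (<-trans i1<i2 (n<1+n i2)) (trans (sym w-i2) short)

  -- Rule for j = i+2: the cycle turns {i, i+1}, {i+2, i+3} into {i+1, i+2}, {i, i+3}.
  -- The two short chords at i and i+2 are replaced by the single one at i+1, which is now
  -- the last, and its left neighbour i is paired with i+3.
  module AdjacentRule {v : Vec (Fin m) m} (pv : IsPairing v) {i : ℕ} (two : TwoLast v i (2 + i)) where
    open Cycle pv two

    i3 : ℕ
    i3 = 3 + i

    w-i3 : partner w i3 ≡ i
    w-i3 = trans w-j1 (trans (cong g short-j) g-j1)

    w-i-i3 : partner w i ≡ i3
    w-i-i3 = trans w-i g-i2

    agree : ∀ k → k < m → k ≢ i → k ≢ i1 → k ≢ i2 → isShort v k ≡ isShort w k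
    agree k k<m k≢i k≢i1 k≢i2 with k ≟ i3
    ... | yes refl = isShort-neither v w
      (λ short → <⇒≢ (<-trans i2<j1 (n<1+n i3)) (trans (sym back-j) short))
      (λ short → <⇒≢ (<-trans i<j1 (n<1+n i3)) (trans (sym w-i3) short))
    ... | no k≢i3 = isShort-cong v w
      (sym (w-other k<m k≢i k≢i1 k≢i2 (λ k≡vi2 → k≢i3 (trans k≡vi2 short-j)) k≢i2 k≢i3))

    reduction : Reduction v τs
    reduction = record
      { bounded = bounded
      ; fewer = count-drop (isShort v) (isShort w) m (i ∷ i1 ∷ i2 ∷ [])
          ((<⇒≢ i<i1 ∷ <⇒≢ i<i2 ∷ []) ∷ (<⇒≢ i1<i2 ∷ []) ∷ [] ∷ [])
          (i<m ∷ i1<m ∷ i2<m ∷ [])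
          (λ k k<m k∉ → agree k k<m (k∉ ∘ here) (k∉ ∘ there ∘ here) (k∉ ∘ there ∘ there ∘ here))
          (trans (values-hits (isShort v) (i ∷ i1 ∷ i2 ∷ []) (values₃ (isShort v)
                   (isShort-true v short-i)
                   (isShort-false v λ short → <⇒≢ (<-trans i<i1 (n<1+n i1)) (trans (sym back-i) short))
                   (isShort-true v short-j)))
                 (cong suc (sym (values-hits (isShort w) (i ∷ i1 ∷ i2 ∷ []) (values₃ (isShort w)
                   (isShort-false w λ short → <⇒≢ i1<j1 (sym (trans (sym w-i-i3) short)))
                   i1-short
                   (isShort-false w i2-notShort))))))
      ; marker = i1
      ; marker-last = record
        { last<b = i1<m
        ; holds = i1-short
        ; fails-above = fails-above }
      ; decodes = trans (cong (decodeMove i) w-i-i3) (decodeMove-adjacent i) }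
      where
      fails-above : ∀ k → i1 < k → k < m → isShort w k ≡ false
      fails-above k i1<k k<m with k ≟ i2
      ... | yes refl = isShort-false w i2-notShort
      ... | no k≢i2 = trans (sym (agree k k<m (>⇒≢ i<k) (>⇒≢ i1<k) k≢i2))
                            (isShort-false v (none-after-i i<k k≢i2 k<m))
        where i<k = <-trans i<i1 i1<k

  -- Rule for j ≥ i+3 when i+2 is paired with j-1 = jm: the cycle turns {i, i+1}, {i+2, jm},
  -- {j, j+1} into {i+1, i+2}, {jm, j+1}, {i, j}.  The short chords at i and j are replaced
  -- by the single one at i+1, which is now the last, and its left neighbour i is paired with j.
  module ApartRule {v : Vec (Fin m) m} (pv : IsPairing v) {i jm : ℕ} (two : TwoLast v i (suc jm))
    (3+i≤jm : 3 + i ≤ jm) (paired : partner v (2 + i) ≡ jm) where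
    open Cycle pv two

    j : ℕ
    j = suc jm

    i2<jm : i2 < jm
    i2<jm = 3+i≤jm
    i1<j : i1 < j
    i1<j = <-trans i1<i2 (<-trans i2<jm (n<1+n jm))
    i<j′ : i < j
    i<j′ = <-trans i<i1 i1<j
    jm<m : jm < m
    jm<m = <-trans (n<1+n jm) j<m

    g-jm : g jm ≡ jm
    g-jm = g-other (>⇒≢ (<-trans i<i2 i2<jm)) (>⇒≢ i2<jm) (<⇒≢ (<-trans (n<1+n jm) (n<1+n j)))

    g-j : g j ≡ j
    g-j = g-other (>⇒≢ i<j′) (>⇒≢ (<-trans i2<jm (n<1+n jm))) (<⇒≢ (n<1+n j))

    w-i-j : partner w i ≡ j
    w-i-j = trans w-i g-j

    w-j1-jm : partner w j1 ≡ jm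
    w-j1-jm = trans w-j1 (trans (cong g paired) g-jm)

    w-jm : partner w jm ≡ j1
    w-jm = trans (image jm<m g-jm) (trans (cong g (partner-back pv i2<m paired)) g-i2)

    w-j : partner w j ≡ i
    w-j = trans (image j<m g-j) (trans (cong g short-j) g-j1)

    j-notShort : partner w j ≢ suc j
    j-notShort short = <⇒≢ (<-trans i<j′ (n<1+n j)) (trans (sym w-j) short)

    agree : ∀ k → k < m → k ≢ i → k ≢ i1 → k ≢ j → isShort v k ≡ isShort w k
    agree k k<m k≢i k≢i1 k≢j with k ≟ i2 | k ≟ jm | k ≟ j1
    ... | yes refl | _ | _ = isShort-neither v w
      (none-between i2 i<i2 (<-trans i2<jm (n<1+n jm))) i2-notShort
    ... | no _ | yes refl | _ = isShort-neither v w
      (λ short → <⇒≢ (<-trans i2<jm (n<1+n jm)) (trans (sym (partner-back pv i2<m paired)) short))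
      (λ short → <⇒≢ (n<1+n j) (sym (trans (sym w-jm) short)))
    ... | no _ | no _ | yes refl = isShort-neither v w
      (λ short → <⇒≢ (<-trans (n<1+n j) (n<1+n j1)) (trans (sym back-j) short))
      (λ short → <⇒≢ (<-trans (n<1+n jm) (<-trans (n<1+n j) (n<1+n j1))) (trans (sym w-j1-jm) short))
    ... | no k≢i2 | no k≢jm | no k≢j1 = isShort-cong v w
      (sym (w-other k<m k≢i k≢i1 k≢i2 (λ k≡vi2 → k≢jm (trans k≡vi2 paired)) k≢j k≢j1))

    reduction : Reduction v τs
    reduction = record
      { bounded = bounded
      ; fewer = count-drop (isShort v) (isShort w) m (i ∷ i1 ∷ j ∷ [])
          ((<⇒≢ i<i1 ∷ <⇒≢ i<j′ ∷ []) ∷ (<⇒≢ i1<j ∷ []) ∷ [] ∷ [])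
          (i<m ∷ i1<m ∷ j<m ∷ [])
          (λ k k<m k∉ → agree k k<m (k∉ ∘ here) (k∉ ∘ there ∘ here) (k∉ ∘ there ∘ there ∘ here))
          (trans (values-hits (isShort v) (i ∷ i1 ∷ j ∷ []) (values₃ (isShort v)
                   (isShort-true v short-i)
                   (isShort-false v λ short → <⇒≢ (<-trans i<i1 (n<1+n i1)) (trans (sym back-i) short))
                   (isShort-true v short-j)))
                 (cong suc (sym (values-hits (isShort w) (i ∷ i1 ∷ j ∷ []) (values₃ (isShort w)
                   (isShort-false w λ short → <⇒≢ i1<j (sym (trans (sym w-i-j) short)))
                   i1-short
                   (isShort-false w j-notShort))))))
      ; marker = i1
      ; marker-last = record
        { last<b = i1<m
        ; holds = i1-short
        ; fails-above = fails-above }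
      ; decodes = trans (cong (decodeMove i) w-i-j)
          (decodeMove-cycle (<⇒≱ (<-trans i<j′ (n<1+n j))) (>⇒≢ (s≤s 3+i≤jm))) }
      where
      fails-above : ∀ k → i1 < k → k < m → isShort w k ≡ false
      fails-above k i1<k k<m with k ≟ j
      ... | yes refl = isShort-false w j-notShort
      ... | no k≢j = trans (sym (agree k k<m (>⇒≢ i<k) (>⇒≢ i1<k) k≢j))
                           (isShort-false v (none-after-i i<k k≢j k<m))
        where i<k = <-trans i<i1 i1<k

module _ {m : ℕ} where

  reduction : {v : Vec (Fin m) m} → IsPairing v → ∀ {i j} → TwoLast v i j → Reduction v (chooseMove v i j)
  reduction {v} pv {i} {zero} two = ⊥-elim (n≮0 (TwoLast.i<j two))
  reduction {v} pv {i} {suc jm} two with 3 + i ≤? suc jm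
  ... | no 3+i≰j with ≤-antisym (TwoLastFacts.2+i≤j pv two) (≤-pred (≰⇒> 3+i≰j))
  ...   | refl = subst (Reduction v) (sym (chooseMove-adjacent v 3+i≰j)) (AdjacentRule.reduction pv two)
  reduction {v} pv {i} {suc jm} two | yes 3+i≤j with partner v (2 + i) ≟ jm
  ... | yes paired = subst (Reduction v) (sym (chooseMove-apart v 3+i≤j paired))
                       (ApartRule.reduction pv two 3+i≤jm paired)
    where
    -- i+2 is not a fixed point, so it is not jm itself
    3+i≤jm : 3 + i ≤ jm
    3+i≤jm = ≤∧≢⇒< (s≤s⁻¹ 3+i≤j) λ 2+i≡jm →
      proj₂ (pv (2 + i) (<-trans 3+i≤j (TwoLastFacts.j<m pv two))) (trans paired (sym 2+i≡jm))
  ... | no unpaired = subst (Reduction v) (sym (chooseMove-swap v 3+i≤j unpaired))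
                        (SwapRule.reduction pv two (s≤s⁻¹ 3+i≤j) unpaired)

  -- Apply the chosen move to the two last short chords (the identity if there are fewer).
  reduceAt : Vec (Fin m) m → ℕ × ℕ → Vec (Fin m) m
  reduceAt v (i , j) = applyMove (chooseMove v i j) v

  reduce : Vec (Fin m) m → Vec (Fin m) m
  reduce v = maybe (reduceAt v) v (lastTwo (isShort v) m)

  restoreAt : Vec (Fin m) m → ℕ → Vec (Fin m) m
  restoreAt w s = undoMove (decodeMove (pred s) (partner w (pred s))) w

  restore : Vec (Fin m) m → Vec (Fin m) m
  restore w = maybe (restoreAt w) w (findLast (isShort w) m)

  reduce-spec : {v : Vec (Fin m) m} → IsPairing v → ∀ {t} → count (isShort v) m ≡ suc (suc t) →
    Σ Move λ τs → reduce v ≡ applyMove τs v × Reduction v τs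
  reduce-spec {v} pv {t} counted with lastTwo-spec (isShort v) m t counted
  ... | i , j , found , last-j , last-i =
    chooseMove v i j , cong (maybe (reduceAt v) v) found , reduction pv (twoLast pv last-j last-i)

  module _ {v : Vec (Fin m) m} (pv : IsPairing v) {t : ℕ} (counted : count (isShort v) m ≡ suc (suc t)) where
    private
      τs : Move
      τs = proj₁ (reduce-spec pv counted)
      reduce≡ : reduce v ≡ applyMove τs v
      reduce≡ = proj₁ (proj₂ (reduce-spec pv counted))
      open Reduction (proj₂ (proj₂ (reduce-spec pv counted)))
      w : Vec (Fin m) m
      w = applyMove τs v

    reduce-pairing : IsPairing (reduce v)
    reduce-pairing = subst IsPairing (sym reduce≡)
      (conjugate-pairing (move-permutation τs bounded) v pv)

    reduce-fewer : count (isShort v) m ≡ suc (count (isShort (reduce v)) m)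
    reduce-fewer = subst (λ u → count (isShort v) m ≡ suc (count (isShort u) m)) (sym reduce≡) fewer

    restore-reduce : restore (reduce v) ≡ v
    restore-reduce = begin
      restore (reduce v)
        ≡⟨ cong restore reduce≡ ⟩
      maybe (restoreAt w) w (findLast (isShort w) m)
        ≡⟨ cong (maybe (restoreAt w) w) (findLast-complete (isShort w) m marker-last) ⟩
      undoMove (decodeMove (pred marker) (partner w (pred marker))) w
        ≡⟨ cong (λ σs → undoMove σs w) decodes ⟩
      undoMove τs (applyMove τs v)
        ≡⟨ conjugate-cancel (move-permutation τs bounded) v ⟩
      v ∎
      where open ≡-Reasoning

L-decreasing : ∀ n t → L n (2 + t) ≤ L n (1 + t)
L-decreasing n t = filter-length-≤ with2+t? with1+t? (allVecs-unique (n + n) (n + n))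
  (allVecs-complete (n + n) (n + n)) reduce restore fewer-shorts retract
  where
  Diagrams : Set
  Diagrams = Vec (Fin (n + n)) (n + n)
  with2+t? : (v : Diagrams) → Dec (IsChordDiagram v × shortCount v ≡ 2 + t)
  with2+t? v = isChordDiagram? v ×-dec (shortCount v ≟ 2 + t)
  with1+t? : (v : Diagrams) → Dec (IsChordDiagram v × shortCount v ≡ 1 + t)
  with1+t? v = isChordDiagram? v ×-dec (shortCount v ≟ 1 + t)
  counted : ∀ {v : Diagrams} → shortCount v ≡ 2 + t → count (isShort v) (n + n) ≡ 2 + t
  counted {v} sc = trans (sym (shortCount≡count v)) sc
  fewer-shorts : ∀ {v : Diagrams} → IsChordDiagram v × shortCount v ≡ 2 + t →
    IsChordDiagram (reduce v) × shortCount (reduce v) ≡ 1 + t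
  fewer-shorts {v} (cd , sc) =
    pairing⇒chordDiagram (reduce v) (reduce-pairing pv (counted sc)) ,
    trans (shortCount≡count (reduce v)) (suc-injective (trans (sym (reduce-fewer pv (counted sc))) (counted sc)))
    where pv = chordDiagram⇒pairing v cd
  retract : ∀ {v : Diagrams} → IsChordDiagram v × shortCount v ≡ 2 + t → restore (reduce v) ≡ v
  retract {v} (cd , sc) = restore-reduce (chordDiagram⇒pairing v cd) (counted sc)

unimodal-from-1 : ∀ (a : ℕ → ℕ) n → 1 ≤ n → (∀ t → a (2 + t) ≤ a (1 + t)) → Unimodal a n
unimodal-from-1 a n 1≤n decreasing with a 0 ≤? a 1
... | yes a0≤a1 = 1 , 1≤n , up , down
  where
  up : ∀ i → i < 1 → a i ≤ a (suc i)
  up zero _ = a0≤a1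
  up (suc i) (s≤s ())
  down : ∀ i → 1 ≤ i → i < n → a (suc i) ≤ a i
  down (suc t) _ _ = decreasing t
... | no a0≰a1 = 0 , z≤n , (λ i ()) , down
  where
  down : ∀ i → 0 ≤ i → i < n → a (suc i) ≤ a i
  down zero _ _ = <⇒≤ (≰⇒> a0≰a1)
  down (suc t) _ _ = decreasing t

mainTheorem1 : (n : ℕ) → 1 ≤ n → Unimodal (L n) n
mainTheorem1 n 1≤n = unimodal-from-1 (L n) n 1≤n (L-decreasing n)
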